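{- Let $S\subseteq\mathbb{N}$, $w\in\{0,1\}^s$ and $T=T^{\chi_S}_w$. Then for every $n\in\mathbb{N}$, $f_T(n)\le f_S(n)+s$. Moreover, $\omega_T(n)\le\omega_S(n)$ provided that $3f_S(n)+3s\le n$.
   Context: $\chi_S$ is the characteristic function of $S$; for $\chi\colon\mathbb{N}\to\{0,1\}$ and $w\in\{0,1\}^s$, $T^\chi_w=\{m\in\mathbb{N}:\chi(m+i)=w(i)\text{ for all }i\in\{0,\dots,s-1\}\}$. For an interval $\Delta\subseteq\mathbb{N}$ and $\omega\in\mathbb{N}$, a set $U\subseteq\mathbb{N}$ is periodic on $\Delta$ with period $\omega$ if for all $x$ with $x,x+\omega\in\Delta$: $x\in U\iff x+\omega\in U$. For $U\subseteq\mathbb{N}$ and $n\in\mathbb{N}$, $f_U(n)$ is the least $\ell\in\mathbb{N}$ such that for some $\omega\in\mathbb{N}$ with $0<\omega\le\ell$, $U$ is periodic on $\{i\in\mathbb{N}:\ell-\omega\le i\le n-(\ell-\omega)\}$ with period $\omega$; and $\omega_U(n)$ is the least $\omega\in\mathbb{Z}_+$ such that $U$ is periodic on $\{i\in\mathbb{N}:f_U(n)-\omega\le i\le n-(f_U(n)-\omega)\}$ with period $\omega$. -}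

module Defs where

open import Data.Nat using (ℕ; _+_; _≤_; _<_)
open import Data.Bool using (Bool; true)
open import Data.Fin using (Fin; toℕ)
open import Data.Product using (_×_)
open import Relation.Nullary using (¬_)
open import Relation.Binary.PropositionalEquality using (_≡_)
open import Function.Bundles using (_⇔_)

Subset : Set₁
Subset = ℕ → Set

SetOf : (ℕ → Bool) → Subset
SetOf χ m = χ m ≡ true

T[_,_] : (ℕ → Bool) → {s : ℕ} → (Fin s → Bool) → Subset
T[ χ , w ] m = ∀ i → χ (m + toℕ i) ≡ w i

PeriodicOn : Subset → (ℕ → Set) → ℕ → Set
PeriodicOn U Δ ω = ∀ x → Δ x → Δ (x + ω) → (U x ⇔ U (x + ω))

-- The interval { i ∈ ℕ : ℓ - ω ≤ i ≤ n - (ℓ - ω) }, with ℓ - ω read as an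
-- integer; written subtraction-free:  ℓ ≤ i + ω  and  i + ℓ ≤ n + ω.
Window : ℕ → ℕ → ℕ → ℕ → Set
Window n ℓ ω i = (ℓ ≤ i + ω) × (i + ℓ ≤ n + ω)

Least : (ℕ → Set) → ℕ → Set
Least P ℓ = P ℓ × (∀ k → k < ℓ → ¬ P k)

FCond : Subset → ℕ → ℕ → Set
FCond U n ℓ = ∃ω
  where
  open import Data.Product using (Σ)
  ∃ω = Σ ℕ λ ω → (0 < ω) × (ω ≤ ℓ) × PeriodicOn U (Window n ℓ ω) ω

IsF : Subset → ℕ → ℕ → Set
IsF U n ℓ = Least (FCond U n) ℓ

OmegaCond : Subset → ℕ → ℕ → ℕ → Set
OmegaCond U n ℓ ω = (0 < ω) × PeriodicOn U (Window n ℓ ω) ω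

IsOmega : Subset → ℕ → ℕ → Set
IsOmega U n ω = ∀ ℓ → IsF U n ℓ → Least (OmegaCond U n ℓ) ω

{-# OPTIONS --safe #-}
-- If S is ω-periodic on a window, then the set T of occurrences of the length-s word w is
-- ω-periodic on the window shrunk by s: this gives f_T ≤ f_S + s, and shows T is ω_S-periodic
-- on the window of width L = f_S + s.  T is also ω_T-periodic on the wider window of width f_T ≤ L, and ω_T ≤ f_T.
-- If ω_S < ω_T, then shifting by ω_T transports "x ∈ T ⇔ x + ω_S ∈ T" from the inner window,
-- which contains ω_T consecutive points once 3L ≤ n, to the whole wider window; so ω_S would be
-- a smaller admissible period than ω_T.
module Submission where

open import Defs
open import Data.Nat using (ℕ; zero; suc; _+_; _*_; _∸_; _≤_; _<_; _≤?_; _<?_; z≤n; s≤s⁻¹)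
open import Data.Nat.Properties
open import Algebra.Properties.CommutativeSemigroup +-commutativeSemigroup
  using () renaming (xy∙z≈xz∙y to +-rightComm)
open import Data.Bool using (Bool)
open import Data.Bool.Properties using (⇔→≡)
open import Data.Fin using (Fin; toℕ)
open import Data.Fin.Properties using (toℕ<n)
open import Data.Product using (_×_; _,_; proj₁; proj₂)
open import Function.Bundles using (_⇔_; mk⇔; Equivalence)
import Function.Properties.Equivalence as ⇔
open import Relation.Nullary using (yes; no; contradiction)
open import Relation.Binary.PropositionalEquality using (_≡_; sym; trans; cong; subst)

open Equivalence using (to; from)

least-≤ : {P : ℕ → Set} {ℓ k : ℕ} → Least P ℓ → P k → ℓ ≤ k
least-≤ (_ , minimal) Pk = ≮⇒≥ (λ k<ℓ → minimal _ k<ℓ Pk)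

⇔-resp-⇔ : {A A′ B B′ : Set} → A ⇔ A′ → B ⇔ B′ → (A ⇔ B) ⇔ (A′ ⇔ B′)
⇔-resp-⇔ A⇔A′ B⇔B′ = mk⇔
  (λ A⇔B → ⇔.trans (⇔.sym A⇔A′) (⇔.trans A⇔B B⇔B′))
  (λ A′⇔B′ → ⇔.trans A⇔A′ (⇔.trans A′⇔B′ (⇔.sym B⇔B′)))

m∸n≤o⇒m≤o+n : ∀ {m n o} → m ∸ n ≤ o → m ≤ o + n
m∸n≤o⇒m≤o+n {m} {n} {o} m∸n≤o =
  ≤-trans (m≤n+m∸n m n) (≤-trans (+-monoʳ-≤ n m∸n≤o) (≤-reflexive (+-comm n o)))

periodic-spread : (G : ℕ → Set) {p a b c : ℕ} → 0 < p → a ≤ c → c + p ≤ suc b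
  → (∀ x → a ≤ x → x + p ≤ b → G x ⇔ G (x + p))
  → (∀ x → c ≤ x → x < c + p → G x)
  → ∀ x → a ≤ x → x ≤ b → G x
periodic-spread G {p} {a} {b} {c} 0<p a≤c c+p≤1+b step core = spread
  where
  up : ∀ k x → c ≤ x + k → a ≤ x → x < c + p → G x
  up k x c≤x+k a≤x x<c+p with c ≤? x
  ... | yes c≤x = core x c≤x x<c+p
  up zero    x c≤x+0   _   _     | no c≰x = contradiction (subst (c ≤_) (+-identityʳ x) c≤x+0) c≰x
  up (suc k) x c≤x+1+k a≤x x<c+p | no c≰x =
    from (step x a≤x x+p≤b) (up k (x + p) c≤x+p+k (≤-trans a≤x (m≤m+n x p)) x+p<c+p)
    where
    x+p<c+p : x + p < c + p
    x+p<c+p = +-monoˡ-< p (≰⇒> c≰x)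
    x+p≤b : x + p ≤ b
    x+p≤b = s≤s⁻¹ (≤-trans x+p<c+p c+p≤1+b)
    c≤x+p+k : c ≤ x + p + k
    c≤x+p+k = ≤-trans (subst (c ≤_) (+-suc x k) c≤x+1+k) (+-monoˡ-≤ k (m<m+n x 0<p))

  down : ∀ k x → x ≤ k + c → c ≤ x → x ≤ b → G x
  down k x x≤k+c c≤x x≤b with x <? c + p
  ... | yes x<c+p = core x c≤x x<c+p
  down zero    x x≤c     c≤x x≤b | no x≮c+p =
    contradiction (≤-<-trans x≤c (m<m+n c 0<p)) x≮c+p
  down (suc k) x x≤1+k+c c≤x x≤b | no x≮c+p =
    subst G y+p≡x (to (step y a≤y (subst (_≤ b) (sym y+p≡x) x≤b)) (down k y y≤k+c c≤y y≤b))
    where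
    c+p≤x : c + p ≤ x
    c+p≤x = ≮⇒≥ x≮c+p
    y : ℕ
    y = x ∸ p
    y+p≡x : y + p ≡ x
    y+p≡x = m∸n+n≡m (≤-trans (m≤n+m p c) c+p≤x)
    c≤y : c ≤ y
    c≤y = m+n≤o⇒m≤o∸n c c+p≤x
    a≤y : a ≤ y
    a≤y = ≤-trans a≤c c≤y
    y≤k+c : y ≤ k + c
    y≤k+c = ≤-trans (∸-monoʳ-≤ x 0<p) (∸-monoˡ-≤ 1 x≤1+k+c)
    y≤b : y ≤ b
    y≤b = ≤-trans (m∸n≤m x p) x≤b

  spread : ∀ x → a ≤ x → x ≤ b → G x
  spread x a≤x x≤b with x <? c + p
  ... | yes x<c+p = up c x (m≤n+m c x) a≤x x<c+p
  ... | no  x≮c+p = down x x (m≤m+n x c) (≤-trans (m≤m+n c p) (≮⇒≥ x≮c+p)) x≤b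

-- x and x + ω both lie in Window n ℓ ω exactly when ℓ ≤ x + ω and x + ℓ ≤ n.
WindowPeriodic : Subset → ℕ → ℕ → ℕ → Set
WindowPeriodic U n ℓ ω = ∀ x → ℓ ≤ x + ω → x + ℓ ≤ n → U x ⇔ U (x + ω)

module _ {U : Subset} {n ℓ ω : ℕ} where

  periodicOn⇒windowPeriodic : PeriodicOn U (Window n ℓ ω) ω → WindowPeriodic U n ℓ ω
  periodicOn⇒windowPeriodic periodic x ℓ≤x+ω x+ℓ≤n = periodic x
    (ℓ≤x+ω , ≤-trans x+ℓ≤n (m≤m+n n ω))
    (≤-trans ℓ≤x+ω (m≤m+n (x + ω) ω) , ≤-trans (≤-reflexive (+-rightComm x ω ℓ)) (+-monoˡ-≤ ω x+ℓ≤n))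

  windowPeriodic⇒periodicOn : WindowPeriodic U n ℓ ω → PeriodicOn U (Window n ℓ ω) ω
  windowPeriodic⇒periodicOn periodic x (ℓ≤x+ω , _) (_ , x+ω+ℓ≤n+ω) = periodic x ℓ≤x+ω
    (+-cancelʳ-≤ ω (x + ℓ) n (≤-trans (≤-reflexive (+-rightComm x ℓ ω)) x+ω+ℓ≤n+ω))

windowPeriodic-T : ∀ {χ : ℕ → Bool} {s} {w : Fin s → Bool} {n ℓ ω}
  → WindowPeriodic (SetOf χ) n ℓ ω → WindowPeriodic T[ χ , w ] n (ℓ + s) ω
windowPeriodic-T {χ} {s} {w} {n} {ℓ} {ω} periodic x ℓ+s≤x+ω x+[ℓ+s]≤n =
  mk⇔ (λ t i → trans (sym (χ-shift i)) (t i)) (λ t i → trans (χ-shift i) (t i))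
  where
  χ-shift : ∀ i → χ (x + toℕ i) ≡ χ (x + ω + toℕ i)
  χ-shift i = trans (⇔→≡ (periodic (x + toℕ i) ℓ≤x+i+ω x+i+ℓ≤n)) (cong χ (+-rightComm x (toℕ i) ω))
    where
    ℓ≤x+i+ω : ℓ ≤ x + toℕ i + ω
    ℓ≤x+i+ω = ≤-trans (m≤m+n ℓ s) (≤-trans ℓ+s≤x+ω (+-monoˡ-≤ ω (m≤m+n x (toℕ i))))
    x+i+ℓ≤n : x + toℕ i + ℓ ≤ n
    x+i+ℓ≤n = ≤-trans (≤-reflexive (trans (+-assoc x (toℕ i) ℓ) (cong (x +_) (+-comm (toℕ i) ℓ))))
      (≤-trans (+-monoʳ-≤ x (+-monoʳ-≤ ℓ (<⇒≤ (toℕ<n i)))) x+[ℓ+s]≤n)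

windowPeriodic-shorten : (U : Subset) {n A L p q : ℕ} → q < p → p ≤ L → A ≤ L → 3 * L ≤ n
  → WindowPeriodic U n A p → WindowPeriodic U n L q → WindowPeriodic U n A q
windowPeriodic-shorten U {n} {A} {L} {p} {q} q<p p≤L A≤L 3L≤n p-periodic q-periodic y A≤y+q y+A≤n =
  periodic-spread G (≤-<-trans z≤n q<p) (∸-monoˡ-≤ q A≤L) L∸q+p≤1+[n∸A] shift core
    y (m≤n+o⇒m∸n≤o A q (subst (A ≤_) (+-comm y q) A≤y+q)) (m+n≤o⇒m≤o∸n y y+A≤n)
  where
  G : ℕ → Set
  G x = U x ⇔ U (x + q)

  L+L+L≤n : L + L + L ≤ n
  L+L+L≤n = subst (_≤ n) (sym (trans (+-assoc L L L) (cong (λ m → L + (L + m)) (sym (+-identityʳ L))))) 3L≤n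
  L∸q+p≤2L : L ∸ q + p ≤ L + L
  L∸q+p≤2L = +-mono-≤ (m∸n≤m L q) p≤L
  L∸q+p≤1+[n∸A] : L ∸ q + p ≤ suc (n ∸ A)
  L∸q+p≤1+[n∸A] = m≤n⇒m≤1+n (≤-trans L∸q+p≤2L (≤-trans (m+n≤o⇒m≤o∸n (L + L) L+L+L≤n) (∸-monoʳ-≤ n A≤L)))

  shift : ∀ x → A ∸ q ≤ x → x + p ≤ n ∸ A → G x ⇔ G (x + p)
  shift x A∸q≤x x+p≤n∸A = ⇔-resp-⇔
    (p-periodic x (≤-trans A≤x+q (+-monoʳ-≤ x q≤p)) (≤-trans (+-monoˡ-≤ A (m≤m+n x p)) x+p+A≤n))
    (subst (λ m → U (x + q) ⇔ U m) (+-rightComm x q p)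
      (p-periodic (x + q) (≤-trans A≤x+q (m≤m+n (x + q) p)) (≤-trans (+-monoˡ-≤ A (+-monoʳ-≤ x q≤p)) x+p+A≤n)))
    where
    q≤p : q ≤ p
    q≤p = <⇒≤ q<p
    A≤x+q : A ≤ x + q
    A≤x+q = m∸n≤o⇒m≤o+n A∸q≤x
    x+p+A≤n : x + p + A ≤ n
    x+p+A≤n = m≤o∸n⇒m+n≤o (x + p) (≤-trans A≤L (≤-trans (m≤n+m L (L + L)) L+L+L≤n)) x+p≤n∸A

  core : ∀ x → L ∸ q ≤ x → x < L ∸ q + p → G x
  core x L∸q≤x x<L∸q+p = q-periodic x (m∸n≤o⇒m≤o+n L∸q≤x)
    (≤-trans (+-monoˡ-≤ L (≤-trans (<⇒≤ x<L∸q+p) L∸q+p≤2L)) L+L+L≤n)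

fCond-T : ∀ {χ : ℕ → Bool} {s} {w : Fin s → Bool} {n ℓ}
  → FCond (SetOf χ) n ℓ → FCond T[ χ , w ] n (ℓ + s)
fCond-T {s = s} (ω , 0<ω , ω≤ℓ , periodic) =
  ω , 0<ω , m≤n⇒m≤n+o s ω≤ℓ ,
  windowPeriodic⇒periodicOn (windowPeriodic-T (periodicOn⇒windowPeriodic periodic))

omega≤f : ∀ {U n ℓ ω} → IsF U n ℓ → Least (OmegaCond U n ℓ) ω → ω ≤ ℓ
omega≤f ((ω′ , 0<ω′ , ω′≤ℓ , periodic) , _) least = ≤-trans (least-≤ least (0<ω′ , periodic)) ω′≤ℓ

lemma3p5 : (χ : ℕ → Bool) (s : ℕ) (w : Fin s → Bool) (n : ℕ)
    → (fS fT : ℕ) → IsF (SetOf χ) n fS → IsF T[ χ , w ] n fT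
    → (fT ≤ fS + s)
      × ((ωS ωT : ℕ) → IsOmega (SetOf χ) n ωS → IsOmega T[ χ , w ] n ωT
         → 3 * fS + 3 * s ≤ n → ωT ≤ ωS)
lemma3p5 χ s w n fS fT isFS isFT = fT≤fS+s , ωT≤ωS
  where
  T : Subset
  T = T[ χ , w ]

  fT≤fS+s : fT ≤ fS + s
  fT≤fS+s = least-≤ isFT (fCond-T (proj₁ isFS))

  ωT≤ωS : (ωS ωT : ℕ) → IsOmega (SetOf χ) n ωS → IsOmega T n ωT → 3 * fS + 3 * s ≤ n → ωT ≤ ωS
  ωT≤ωS ωS ωT isΩS isΩT 3fS+3s≤n with isΩS fS isFS | isΩT fT isFT
  ... | (0<ωS , periodicS) , _ | leastT@((_ , periodicT) , minimalT) = ≮⇒≥ λ ωS<ωT →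
    minimalT ωS ωS<ωT (0<ωS , windowPeriodic⇒periodicOn
      (windowPeriodic-shorten T ωS<ωT (≤-trans (omega≤f isFT leastT) fT≤fS+s) fT≤fS+s 3[fS+s]≤n
        (periodicOn⇒windowPeriodic periodicT)
        (windowPeriodic-T (periodicOn⇒windowPeriodic periodicS))))
    where
    3[fS+s]≤n : 3 * (fS + s) ≤ n
    3[fS+s]≤n = subst (_≤ n) (sym (*-distribˡ-+ 3 fS s)) 3fS+3s≤n
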